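{- Let $k\geq 3$ be an integer and $\boldsymbol{d}=(d_1,\ldots,d_n)$ a sequence of nonnegative integers such that $\mathcal{B}(\boldsymbol{d},k)$ is non-empty, and let $B=(X\cup Y,A)$ be a uniformly random element of $\mathcal{B}(\boldsymbol{d},k)$ (distribution $\pi_{\mathcal{B}}$). Suppose there are constants $c_1,c_2$ such that for any $y,y'\in Y$ and any subset $\mathcal{W}\subseteq X$ of size $k$, \[\mathbb{P}_{\pi_{\mathcal{B}}}\big(\mathcal{N}_B(y)=\mathcal{W}\big)\leq c_1\binom{n}{k}^{ -1}\] and \[\mathbb{P}_{\pi_{\mathcal{B}}}\big(\mathcal{N}_B(y')=\mathcal{W}\mid\mathcal{N}_B(y)=\mathcal{W}\big)\leq c_2\,\mathbb{P}_{\pi_{\mathcal{B}}}\big(\mathcal{N}_B(y')=\mathcal{W}\big).\] Then \[\mathbb{P}_{\pi_{\mathcal{B}}}\big(\mathcal{B}^*(\boldsymbol{d},k)\big)\geq 1-c_1c_2\binom{m}{2}\binom{n}{k}^{ -1}.\]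
   Context: With $M=\sum_i d_i$ and $m=M/k$, $\mathcal{B}(\boldsymbol{d},k)$ denotes the set of simple bipartite graphs with fixed parts $X=\{x_1,\ldots,x_n\}$ and $Y=\{y_1,\ldots,y_m\}$ such that $\deg(x_i)=d_i$ for all $i$ and $\deg(y_j)=k$ for all $j$. $\mathcal{N}_B(v)$ is the neighbourhood of $v$ in $B$. $B$ is H-simple if $\mathcal{N}_B(y_i)=\mathcal{N}_B(y_j)$ implies $i=j$; $\mathcal{B}^*(\boldsymbol{d},k)$ is the set of H-simple elements of $\mathcal{B}(\boldsymbol{d},k)$.
   Formalization: The constants $c_1,c_2$ in the two hypotheses are taken in ℚ. -}

module Defs where

open import Data.Bool using (Bool; true; false)
import Data.Bool.Properties as BoolP
open import Data.Nat using (ℕ; zero; suc; _≤_)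
import Data.Nat.DivMod as ND
open import Data.Integer using (+_)
open import Data.Rational using (ℚ; 0ℚ; _/_)
open import Data.List using (List; []; _∷_; map; concatMap; filter; length)
open import Data.Vec using (Vec; []; _∷_; lookup; sum)
import Data.Vec as Vec
open import Data.Vec.Properties using (≡-dec)
open import Data.Fin using (Fin)
open import Data.Fin.Properties using (all?)
import Data.Fin.Properties as FinP
open import Data.Product using (_×_)
open import Relation.Binary.PropositionalEquality using (_≡_)
open import Relation.Nullary using (Dec)
open import Relation.Nullary.Decidable using (_→-dec_; _×-dec_)
open import Relation.Unary using (Decidable)

-- A bipartite graph with parts X = {x_0..x_{n-1}}, Y = {y_0..y_{m-1}} is
-- given by its biadjacency matrix: row j (a Vec Bool n) is the indicator
-- of the neighbourhood N_B(y_j) ⊆ X.  Such graphs are automatically simple.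
Mat : ℕ → ℕ → Set
Mat m n = Vec (Vec Bool n) m

ones : ∀ {n} → Vec Bool n → ℕ
ones [] = 0
ones (true ∷ v) = suc (ones v)
ones (false ∷ v) = ones v

N_Y : ∀ {m n} → Mat m n → Fin m → Vec Bool n
N_Y B j = lookup B j

degX : ∀ {m n} → Mat m n → Fin n → ℕ
degX B i = ones (Vec.map (λ r → lookup r i) B)

degY : ∀ {m n} → Mat m n → Fin m → ℕ
degY B j = ones (lookup B j)

-- M / k  (k ≥ 3 in the theorem; value at k = 0 irrelevant)
quot : ℕ → ℕ → ℕ
quot M zero = 0
quot M (suc k) = M ND./ suc k

mOf : ∀ {n} → Vec ℕ n → ℕ → ℕ
mOf d k = quot (sum d) k

InB : ∀ {n} (d : Vec ℕ n) (k : ℕ) → Mat (mOf d k) n → Set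
InB {n} d k B = ((i : Fin n) → degX B i ≡ lookup d i) × ((j : Fin (mOf d k)) → degY B j ≡ k)

InB? : ∀ {n} (d : Vec ℕ n) (k : ℕ) → Decidable (InB d k)
InB? d k B = all? (λ i → degX B i Data.Nat.≟ lookup d i) ×-dec all? (λ j → degY B j Data.Nat.≟ k)

HSimple : ∀ {m n} → Mat m n → Set
HSimple {m} B = (i j : Fin m) → N_Y B i ≡ N_Y B j → i ≡ j

HSimple? : ∀ {m n} → Decidable (HSimple {m} {n})
HSimple? B = all? (λ i → all? (λ j → ≡-dec BoolP._≟_ (N_Y B i) (N_Y B j) →-dec (i FinP.≟ j)))

vecsOver : ∀ {A : Set} → List A → (m : ℕ) → List (Vec A m)
vecsOver xs zero = [] ∷ []
vecsOver xs (suc m) = concatMap (λ x → map (x ∷_) (vecsOver xs m)) xs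

allMats : (m n : ℕ) → List (Mat m n)
allMats m n = vecsOver (vecsOver (false ∷ true ∷ []) n) m

-- the (finite) set 𝓑(d,k), as a list without repetitions
𝓑 : ∀ {n} (d : Vec ℕ n) (k : ℕ) → List (Mat (mOf d k) n)
𝓑 d k = filter (InB? d k) (allMats (mOf d k) _)

-- a / b as a rational, with the convention a / 0 = 0
frac : ℕ → ℕ → ℚ
frac a zero = 0ℚ
frac a (suc b) = (+ a) / suc b

ℕ→ℚ : ℕ → ℚ
ℕ→ℚ a = (+ a) / 1

-- 1 / a, with the convention 1 / 0 = 0
inv : ℕ → ℚ
inv a = frac 1 a

Prob : ∀ {n} (d : Vec ℕ n) (k : ℕ) {P : Mat (mOf d k) n → Set} → Decidable P → ℚ
Prob d k P? = frac (length (filter P? (𝓑 d k))) (length (𝓑 d k))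

-- conditional probability P(A | C) = P(A ∩ C) / P(C)  (= 0 if P(C) = 0)
CondProb : ∀ {n} (d : Vec ℕ n) (k : ℕ) {P Q : Mat (mOf d k) n → Set}
  → Decidable P → Decidable Q → ℚ
CondProb d k P? Q? =
  frac (length (filter (λ B → P? B ×-dec Q? B) (𝓑 d k))) (length (filter Q? (𝓑 d k)))

NbEq : ∀ {m n} (y : Fin m) (W : Vec Bool n) → Mat m n → Set
NbEq y W B = N_Y B y ≡ W

NbEq? : ∀ {m n} (y : Fin m) (W : Vec Bool n) → Decidable (NbEq y W)
NbEq? y W B = ≡-dec BoolP._≟_ (N_Y B y) W

-- B fails to be H-simple exactly when two distinct vertices y_i, y_j of Y
-- have the same neighbourhood, so (union bound over the (m choose 2) pairs)
--   P(not H-simple) ≤ Σ_{i<j} P(N(y_i) = N(y_j)).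
-- Every neighbourhood N(y_j) is one of the k-subsets W of X, hence
--   P(N(y_i) = N(y_j)) = Σ_W P(N(y_j) = W | N(y_i) = W) P(N(y_i) = W)
--                      ≤ Σ_W c₂ P(N(y_j) = W) c₁ (n choose k)⁻¹ = c₁ c₂ (n choose k)⁻¹,
-- using Σ_W P(N(y_j) = W) = 1.

module Submission where

open import Defs
open import Data.Bool using (Bool)
open import Data.Nat using (ℕ) renaming (_≤_ to _≤ℕ_)
open import Data.Nat.Combinatorics using (_C_)
open import Data.Rational using (ℚ; 1ℚ; _*_; _-_; _≤_)
open import Data.Vec using (Vec)
open import Data.Fin using (Fin)
open import Data.Product using (∃)
open import Relation.Binary.PropositionalEquality using (_≡_; _≢_)

open import Data.Bool using (true; false; if_then_else_)
import Data.Bool.Properties as Bool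
import Data.Nat as Nat
open Nat using (zero; suc; z≤n; s≤s)
import Data.Nat.Properties as Natₚ
open import Data.Nat.Combinatorics using (nC1≡n; nCk+nC[k+1]≡[n+1]C[k+1])
import Data.Nat.Tactic.RingSolver as ℕ-Solver
open import Data.Integer as ℤ using (+_)
import Data.Integer.Properties as ℤ
import Data.Integer.Tactic.RingSolver as ℤ-Solver
open import Data.Rational using (0ℚ; _+_; fromℚᵘ; nonNegative; -_)
open import Data.Rational.Properties
  using ( ≤-refl; ≤-trans; ≤-reflexive; module ≤-Reasoning; +-mono-≤; +-monoʳ-≤; +-monoˡ-≤
        ; *-monoˡ-≤-nonNeg; *-monoʳ-≤-nonNeg; +-identityʳ; *-identityˡ; *-identityʳ; *-zeroˡ; *-zeroʳ
        ; *-distribˡ-+; *-distribʳ-+; toℚᵘ-injective; toℚᵘ-fromℚᵘ; fromℚᵘ-cong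
        ; toℚᵘ-homo-+; toℚᵘ-homo-*; nonNegative⁻¹; normalize-nonNeg)
open import Data.Rational.Solver using (module +-*-Solver)
open import Data.Rational.Unnormalised as ℚᵘ using (mkℚᵘ; *≡*)
import Data.Rational.Unnormalised.Properties as ℚᵘ
open import Data.List using (List; []; _∷_; map; filter; length; _++_; concatMap; allFin)
import Data.List.Properties as List
open import Data.List.Relation.Unary.All as All using (All; []; _∷_)
import Data.List.Relation.Unary.All.Properties as All
open import Data.List.Relation.Unary.Any using (Any; here; there)
open import Data.List.Membership.Propositional using (_∈_; lose)
open import Data.List.Membership.Propositional.Properties using (∈-allFin; ∈-++⁺ˡ; ∈-++⁺ʳ; ∈-map⁺)
open import Data.Vec using ([]; _∷_)
open import Data.Vec.Properties using (≡-dec; ∷-injectiveˡ; ∷-injectiveʳ)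
import Data.Fin as Fin
import Data.Fin.Properties as Fin
open import Data.Product using (_×_; _,_; proj₁; proj₂)
open import Data.Empty using (⊥-elim)
open import Relation.Binary.Definitions using (DecidableEquality; tri<; tri≈; tri>)
open import Relation.Binary.PropositionalEquality using (refl; sym; trans; cong; cong₂; module ≡-Reasoning)
open import Relation.Nullary using (Dec; yes; no; does; ¬_)
open import Relation.Nullary.Decidable using (_→-dec_; _×-dec_)
open import Relation.Unary using (Decidable)

-- Finite sums, indicators and counts over lists

∑ : {A : Set} → List A → (A → ℕ) → ℕ
∑ []       f = 0
∑ (x ∷ xs) f = f x Nat.+ ∑ xs f

𝟙 : {P : Set} → Dec P → ℕ
𝟙 d = if does d then 1 else 0

count : {A : Set} {P : A → Set} → Decidable P → List A → ℕ
count P? xs = length (filter P? xs)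

𝟙-yes : {P : Set} → P → (d : Dec P) → 𝟙 d ≡ 1
𝟙-yes p (yes _) = refl
𝟙-yes p (no ¬p) = ⊥-elim (¬p p)

𝟙-no : {P : Set} → ¬ P → (d : Dec P) → 𝟙 d ≡ 0
𝟙-no ¬p (yes p) = ⊥-elim (¬p p)
𝟙-no ¬p (no _)  = refl

𝟙-cong : {P Q : Set} → (P → Q) → (Q → P) → (d : Dec P) (e : Dec Q) → 𝟙 d ≡ 𝟙 e
𝟙-cong f g (yes p) e = sym (𝟙-yes (f p) e)
𝟙-cong f g (no ¬p) e = sym (𝟙-no (λ q → ¬p (g q)) e)

𝟙-×-≤ : {P Q : Set} (d : Dec (P × Q)) (e : Dec Q) → 𝟙 d ≤ℕ 𝟙 e
𝟙-×-≤ (yes (_ , q)) e = Natₚ.≤-reflexive (sym (𝟙-yes q e))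
𝟙-×-≤ (no _)        e = z≤n

𝟙-∷ : {A : Set} (_≟_ : DecidableEquality A) {m : ℕ} (b c : A) (v w : Vec A m)
  → 𝟙 (≡-dec _≟_ (b ∷ v) (c ∷ w)) ≡ 𝟙 (b ≟ c) Nat.* 𝟙 (≡-dec _≟_ v w)
𝟙-∷ _≟_ b c v w = factor (≡-dec _≟_ (b ∷ v) (c ∷ w)) (b ≟ c) (≡-dec _≟_ v w)
  where
  factor : (D : Dec (b ∷ v ≡ c ∷ w)) (d : Dec (b ≡ c)) (e : Dec (v ≡ w)) → 𝟙 D ≡ 𝟙 d Nat.* 𝟙 e
  factor D (yes refl) (yes refl) = 𝟙-yes refl D
  factor D (yes _)    (no v≢w)   = 𝟙-no (λ eq → v≢w (∷-injectiveʳ eq)) D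
  factor D (no b≢c)   _          = 𝟙-no (λ eq → b≢c (∷-injectiveˡ eq)) D

∑-cong : {A : Set} (xs : List A) (f g : A → ℕ) → (∀ x → f x ≡ g x) → ∑ xs f ≡ ∑ xs g
∑-cong []       f g h = refl
∑-cong (x ∷ xs) f g h = cong₂ Nat._+_ (h x) (∑-cong xs f g h)

∑-cong-on : {A : Set} (xs : List A) (f g : A → ℕ) → All (λ x → f x ≡ g x) xs → ∑ xs f ≡ ∑ xs g
∑-cong-on []       f g []         = refl
∑-cong-on (x ∷ xs) f g (px ∷ pxs) = cong₂ Nat._+_ px (∑-cong-on xs f g pxs)

∑-mono-on : {A : Set} (xs : List A) (f g : A → ℕ) → All (λ x → f x ≤ℕ g x) xs → ∑ xs f ≤ℕ ∑ xs g
∑-mono-on []       f g []         = z≤n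
∑-mono-on (x ∷ xs) f g (px ∷ pxs) = Natₚ.+-mono-≤ px (∑-mono-on xs f g pxs)

∑-zero : {A : Set} (xs : List A) → ∑ xs (λ _ → 0) ≡ 0
∑-zero []       = refl
∑-zero (x ∷ xs) = ∑-zero xs

∑-length : {A : Set} (xs : List A) → ∑ xs (λ _ → 1) ≡ length xs
∑-length []       = refl
∑-length (x ∷ xs) = cong suc (∑-length xs)

∑-+ : {A : Set} (xs : List A) (f g : A → ℕ) → ∑ xs (λ x → f x Nat.+ g x) ≡ ∑ xs f Nat.+ ∑ xs g
∑-+ []       f g = refl
∑-+ (x ∷ xs) f g = trans (cong (f x Nat.+ g x Nat.+_) (∑-+ xs f g)) (interchange (f x) (g x) (∑ xs f) (∑ xs g))
  where
  interchange : ∀ a b c d → (a Nat.+ b) Nat.+ (c Nat.+ d) ≡ (a Nat.+ c) Nat.+ (b Nat.+ d)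
  interchange = ℕ-Solver.solve-∀

∑-*ˡ : {A : Set} (xs : List A) (a : ℕ) (f : A → ℕ) → ∑ xs (λ x → a Nat.* f x) ≡ a Nat.* ∑ xs f
∑-*ˡ []       a f = sym (Natₚ.*-zeroʳ a)
∑-*ˡ (x ∷ xs) a f = trans (cong (a Nat.* f x Nat.+_) (∑-*ˡ xs a f)) (sym (Natₚ.*-distribˡ-+ a (f x) (∑ xs f)))

∑-swap : {A B : Set} (xs : List A) (ys : List B) (f : A → B → ℕ)
  → ∑ xs (λ x → ∑ ys (f x)) ≡ ∑ ys (λ y → ∑ xs (λ x → f x y))
∑-swap []       ys f = sym (∑-zero ys)
∑-swap (x ∷ xs) ys f =
  trans (cong (∑ ys (f x) Nat.+_) (∑-swap xs ys f)) (sym (∑-+ ys (f x) (λ y → ∑ xs (λ x → f x y))))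

∑-++ : {A : Set} (xs ys : List A) (f : A → ℕ) → ∑ (xs ++ ys) f ≡ ∑ xs f Nat.+ ∑ ys f
∑-++ []       ys f = refl
∑-++ (x ∷ xs) ys f = trans (cong (f x Nat.+_) (∑-++ xs ys f)) (sym (Natₚ.+-assoc (f x) (∑ xs f) (∑ ys f)))

∑-map : {A B : Set} (g : A → B) (xs : List A) (f : B → ℕ) → ∑ (map g xs) f ≡ ∑ xs (λ x → f (g x))
∑-map g []       f = refl
∑-map g (x ∷ xs) f = cong (f (g x) Nat.+_) (∑-map g xs f)

∑-concatMap : {A B : Set} (g : A → List B) (xs : List A) (f : B → ℕ)
  → ∑ (concatMap g xs) f ≡ ∑ xs (λ x → ∑ (g x) f)
∑-concatMap g []       f = refl
∑-concatMap g (x ∷ xs) f =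
  trans (∑-++ (g x) (concatMap g xs) f) (cong (∑ (g x) f Nat.+_) (∑-concatMap g xs f))

count-∑ : {A : Set} {P : A → Set} (P? : Decidable P) (xs : List A) → count P? xs ≡ ∑ xs (λ x → 𝟙 (P? x))
count-∑ P? [] = refl
count-∑ P? (x ∷ xs) with does (P? x)
... | true  = cong suc (count-∑ P? xs)
... | false = count-∑ P? xs

∑-filter : {A : Set} {P : A → Set} (P? : Decidable P) (xs : List A) (f : A → ℕ)
  → (∀ x → ¬ P x → f x ≡ 0) → ∑ (filter P? xs) f ≡ ∑ xs f
∑-filter P? [] f h = refl
∑-filter P? (x ∷ xs) f h with P? x
... | yes _  = cong (f x Nat.+_) (∑-filter P? xs f h)
... | no ¬px = trans (∑-filter P? xs f h) (cong (Nat._+ ∑ xs f) (sym (h x ¬px)))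

∑-nonempty : {A : Set} (xs : List A) (f : A → ℕ) → ∑ xs f ≡ 1 → 0 Nat.< length xs
∑-nonempty []       f ()
∑-nonempty (x ∷ xs) f _ = s≤s z≤n

-- Counting principles

double-count : {W A : Set} {Q : W → A → Set} (Q? : ∀ w → Decidable (Q w)) (ws : List W) (L : List A)
  → ∑ ws (λ w → count (Q? w) L) ≡ ∑ L (λ x → ∑ ws (λ w → 𝟙 (Q? w x)))
double-count Q? ws L = trans (∑-cong ws _ _ (λ w → count-∑ (Q? w) L)) (∑-swap ws L _)

count-partition : {W A : Set} {Q : W → A → Set} (Q? : ∀ w → Decidable (Q w)) (ws : List W) (L : List A)
  → All (λ x → ∑ ws (λ w → 𝟙 (Q? w x)) ≡ 1) L → ∑ ws (λ w → count (Q? w) L) ≡ length L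
count-partition Q? ws L once =
  trans (double-count Q? ws L) (trans (∑-cong-on L _ _ once) (∑-length L))

count-cover : {W A : Set} {E : A → Set} {Q : W → A → Set}
  (E? : Decidable E) (Q? : ∀ w → Decidable (Q w)) (ws : List W) (L : List A)
  → All (λ x → 𝟙 (E? x) ≤ℕ ∑ ws (λ w → 𝟙 (Q? w x))) L
  → count E? L ≤ℕ ∑ ws (λ w → count (Q? w) L)
count-cover E? Q? ws L covered = begin
  count E? L                           ≡⟨ count-∑ E? L ⟩
  ∑ L (λ x → 𝟙 (E? x))                 ≤⟨ ∑-mono-on L _ _ covered ⟩
  ∑ L (λ x → ∑ ws (λ w → 𝟙 (Q? w x)))  ≡⟨ double-count Q? ws L ⟨
  ∑ ws (λ w → count (Q? w) L)          ∎
  where open Natₚ.≤-Reasoning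

any-𝟙 : {P A : Set} {E : P → A → Set} (E? : ∀ p → Decidable (E p)) {x : A} (ps : List P)
  → Any (λ p → E p x) ps → 1 ≤ℕ ∑ ps (λ p → 𝟙 (E? p x))
any-𝟙 E? {x} (p ∷ ps) (here e)    = Natₚ.≤-trans (Natₚ.≤-reflexive (sym (𝟙-yes e (E? p x)))) (Natₚ.m≤m+n _ _)
any-𝟙 E? {x} (p ∷ ps) (there any) = Natₚ.≤-trans (any-𝟙 E? ps any) (Natₚ.m≤n+m _ _)

union-bound : {P A : Set} {G : A → Set} {E : P → A → Set}
  (G? : Decidable G) (E? : ∀ p → Decidable (E p)) (ps : List P) (L : List A)
  → (∀ x → ¬ G x → Any (λ p → E p x) ps)
  → length L ≤ℕ count G? L Nat.+ ∑ ps (λ p → count (E? p) L)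
union-bound {A = A} G? E? ps L bad⇒event = begin
  length L                                                        ≡⟨ ∑-length L ⟨
  ∑ L (λ _ → 1)                                                   ≤⟨ ∑-mono-on L _ _ (All.tabulate (λ {x} _ → covered x)) ⟩
  ∑ L (λ x → 𝟙 (G? x) Nat.+ ∑ ps (λ p → 𝟙 (E? p x)))              ≡⟨ ∑-+ L _ _ ⟩
  ∑ L (λ x → 𝟙 (G? x)) Nat.+ ∑ L (λ x → ∑ ps (λ p → 𝟙 (E? p x)))  ≡⟨ cong₂ Nat._+_ (count-∑ G? L) (double-count E? ps L) ⟨
  count G? L Nat.+ ∑ ps (λ p → count (E? p) L)                    ∎
  where
  open Natₚ.≤-Reasoning
  covered : (x : A) → 1 ≤ℕ 𝟙 (G? x) Nat.+ ∑ ps (λ p → 𝟙 (E? p x))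
  covered x with G? x
  ... | yes _  = s≤s z≤n
  ... | no ¬gx = any-𝟙 E? ps (bad⇒event x ¬gx)

count-×-≤ : {A : Set} {P Q : A → Set} (P? : Decidable P) (Q? : Decidable Q) (L : List A)
  → count (λ x → P? x ×-dec Q? x) L ≤ℕ count Q? L
count-×-≤ P? Q? L = begin
  count (λ x → P? x ×-dec Q? x) L  ≡⟨ count-∑ (λ x → P? x ×-dec Q? x) L ⟩
  ∑ L (λ x → 𝟙 (P? x ×-dec Q? x))  ≤⟨ ∑-mono-on L _ _ (All.tabulate (λ {x} _ → 𝟙-×-≤ (P? x ×-dec Q? x) (Q? x))) ⟩
  ∑ L (λ x → 𝟙 (Q? x))             ≡⟨ count-∑ Q? L ⟨
  count Q? L                       ∎
  where open Natₚ.≤-Reasoning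

-- Exhaustive enumerations

ListsOnce : {A : Set} → DecidableEquality A → List A → Set
ListsOnce _≟_ xs = ∀ x → ∑ xs (λ y → 𝟙 (x ≟ y)) ≡ 1

vecsOver-once : {A : Set} (_≟_ : DecidableEquality A) (xs : List A)
  → ListsOnce _≟_ xs → (m : ℕ) → ListsOnce (≡-dec _≟_) (vecsOver xs m)
vecsOver-once _≟_ xs once zero    []      = refl
vecsOver-once {A} _≟_ xs once (suc m) (b ∷ v) = begin
  ∑ (concatMap (λ c → map (c ∷_) (vecsOver xs m)) xs) (hits (b ∷ v))
    ≡⟨ ∑-concatMap (λ c → map (c ∷_) (vecsOver xs m)) xs _ ⟩
  ∑ xs (λ c → ∑ (map (c ∷_) (vecsOver xs m)) (hits (b ∷ v)))
    ≡⟨ ∑-cong xs _ _ (λ c → ∑-map (c ∷_) (vecsOver xs m) _) ⟩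
  ∑ xs (λ c → ∑ (vecsOver xs m) (λ w → 𝟙 (≡-dec _≟_ (b ∷ v) (c ∷ w))))
    ≡⟨ ∑-cong xs _ _ (λ c → ∑-cong (vecsOver xs m) _ _ (λ w → 𝟙-∷ _≟_ b c v w)) ⟩
  ∑ xs (λ c → ∑ (vecsOver xs m) (λ w → 𝟙 (b ≟ c) Nat.* 𝟙 (≡-dec _≟_ v w)))
    ≡⟨ ∑-cong xs _ _ (λ c → ∑-*ˡ (vecsOver xs m) (𝟙 (b ≟ c)) _) ⟩
  ∑ xs (λ c → 𝟙 (b ≟ c) Nat.* ∑ (vecsOver xs m) (hits v))
    ≡⟨ ∑-cong xs _ _ (λ c → trans (cong (𝟙 (b ≟ c) Nat.*_) (vecsOver-once _≟_ xs once m v)) (Natₚ.*-identityʳ _)) ⟩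
  ∑ xs (λ c → 𝟙 (b ≟ c))
    ≡⟨ once b ⟩
  1 ∎
  where
  open ≡-Reasoning
  hits : {n : ℕ} → Vec A n → Vec A n → ℕ
  hits u w = 𝟙 (≡-dec _≟_ u w)

boolVecs-once : (n : ℕ) → ListsOnce (≡-dec Bool._≟_) (vecsOver (false ∷ true ∷ []) n)
boolVecs-once = vecsOver-once Bool._≟_ (false ∷ true ∷ []) (λ { false → refl ; true → refl })

allMats-once : (m n : ℕ) → ListsOnce (≡-dec (≡-dec Bool._≟_)) (allMats m n)
allMats-once m n = vecsOver-once (≡-dec Bool._≟_) (vecsOver (false ∷ true ∷ []) n) (boolVecs-once n) m

filter-once : {A : Set} {P : A → Set} (_≟_ : DecidableEquality A) (P? : Decidable P) (xs : List A)
  → ListsOnce _≟_ xs → (v : A) → P v → ∑ (filter P? xs) (λ w → 𝟙 (v ≟ w)) ≡ 1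
filter-once _≟_ P? xs once v pv =
  trans (∑-filter P? xs _ (λ w ¬pw → 𝟙-no (λ { refl → ¬pw pv }) (v ≟ w))) (once v)

-- the pairs (i , j) with i < j: first those with i = 0, then the shifted pairs of Fin m
pairs : (m : ℕ) → List (Fin m × Fin m)
pairs zero    = []
pairs (suc m) = map (λ j → (Fin.zero , Fin.suc j)) (allFin m) ++ map lift (pairs m)
  where
  lift : Fin m × Fin m → Fin (suc m) × Fin (suc m)
  lift (i , j) = (Fin.suc i , Fin.suc j)

pairs-length : (m : ℕ) → length (pairs m) ≡ m C 2
pairs-length zero    = refl
pairs-length (suc m) = begin
  length (map (λ j → (Fin.zero , Fin.suc j)) (allFin m) ++ map _ (pairs m))
    ≡⟨ List.length-++ (map (λ j → (Fin.zero , Fin.suc j)) (allFin m)) ⟩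
  length (map (λ j → (Fin.zero , Fin.suc j)) (allFin m)) Nat.+ length (map _ (pairs m))
    ≡⟨ cong₂ Nat._+_ (trans (List.length-map _ (allFin m)) (List.length-tabulate (λ j → j)))
                   (trans (List.length-map _ (pairs m)) (pairs-length m)) ⟩
  m Nat.+ m C 2
    ≡⟨ cong (Nat._+ m C 2) (nC1≡n m) ⟨
  m C 1 Nat.+ m C 2
    ≡⟨ nCk+nC[k+1]≡[n+1]C[k+1] m 1 ⟩
  suc m C 2 ∎
  where open ≡-Reasoning

pairs-complete : {m : ℕ} (i j : Fin m) → i Fin.< j → (i , j) ∈ pairs m
pairs-complete {suc m} Fin.zero    (Fin.suc j) _         =
  ∈-++⁺ˡ (∈-map⁺ (λ j → (Fin.zero , Fin.suc j)) (∈-allFin j))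
pairs-complete {suc m} (Fin.suc i) (Fin.suc j) (s≤s i<j) =
  ∈-++⁺ʳ _ (∈-map⁺ (λ p → (Fin.suc (proj₁ p) , Fin.suc (proj₂ p))) (pairs-complete i j i<j))

pairs-distinct : (m : ℕ) → All (λ p → proj₁ p ≢ proj₂ p) (pairs m)
pairs-distinct zero    = []
pairs-distinct (suc m) = All.++⁺ (All.map⁺ (All.tabulate (λ _ ())))
  (All.map⁺ (All.map (λ i≢j eq → i≢j (Fin.suc-injective eq)) (pairs-distinct m)))

collision : {m : ℕ} {X : Set} (_≟_ : DecidableEquality X) (f : Fin m → X)
  → ¬ (∀ i j → f i ≡ f j → i ≡ j) → Any (λ p → f (proj₁ p) ≡ f (proj₂ p)) (pairs m)
collision {m} _≟_ f non-inj with Fin.¬∀⟶∃¬ m _ (λ i → Fin.all? (λ j → (f i ≟ f j) →-dec (i Fin.≟ j))) non-inj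
... | i , ¬inj-i with Fin.¬∀⟶∃¬ m _ (λ j → (f i ≟ f j) →-dec (i Fin.≟ j)) ¬inj-i
... | j , ¬inj-ij with f i ≟ f j
...   | no fi≢fj = ⊥-elim (¬inj-ij (λ fi≡fj → ⊥-elim (fi≢fj fi≡fj)))
...   | yes fi≡fj with Fin.<-cmp i j
...     | tri< i<j _ _ = lose (pairs-complete i j i<j) fi≡fj
...     | tri≈ _ i≡j _ = ⊥-elim (¬inj-ij (λ _ → i≡j))
...     | tri> _ _ j<i = lose (pairs-complete j i j<i) (sym fi≡fj)

-- Fractions a / N with a fixed positive denominator

-- normalisation ℚᵘ → ℚ is a homomorphism (the library states it for toℚᵘ)
fromℚᵘ-homo-+ : ∀ x y → fromℚᵘ (x ℚᵘ.+ y) ≡ fromℚᵘ x + fromℚᵘ y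
fromℚᵘ-homo-+ x y = toℚᵘ-injective (ℚᵘ.≃-trans (toℚᵘ-fromℚᵘ (x ℚᵘ.+ y))
  (ℚᵘ.≃-trans (ℚᵘ.+-cong (ℚᵘ.≃-sym (toℚᵘ-fromℚᵘ x)) (ℚᵘ.≃-sym (toℚᵘ-fromℚᵘ y)))
    (ℚᵘ.≃-sym (toℚᵘ-homo-+ (fromℚᵘ x) (fromℚᵘ y)))))

fromℚᵘ-homo-* : ∀ x y → fromℚᵘ (x ℚᵘ.* y) ≡ fromℚᵘ x * fromℚᵘ y
fromℚᵘ-homo-* x y = toℚᵘ-injective (ℚᵘ.≃-trans (toℚᵘ-fromℚᵘ (x ℚᵘ.* y))
  (ℚᵘ.≃-trans (ℚᵘ.*-cong (ℚᵘ.≃-sym (toℚᵘ-fromℚᵘ x)) (ℚᵘ.≃-sym (toℚᵘ-fromℚᵘ y)))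
    (ℚᵘ.≃-sym (toℚᵘ-homo-* (fromℚᵘ x) (fromℚᵘ y)))))

frac-+ : ∀ a b N → 0 Nat.< N → frac (a Nat.+ b) N ≡ frac a N + frac b N
frac-+ a b (suc n) _ = trans
  (fromℚᵘ-cong {mkℚᵘ (+ (a Nat.+ b)) n} {mkℚᵘ (+ a) n ℚᵘ.+ mkℚᵘ (+ b) n}
    (*≡* (trans (cong₂ ℤ._*_ (ℤ.pos-+ a b) (ℤ.pos-* (suc n) (suc n))) (cross (+ a) (+ b) (+ suc n)))))
  (fromℚᵘ-homo-+ (mkℚᵘ (+ a) n) (mkℚᵘ (+ b) n))
  where
  cross : ∀ (x y z : ℤ.ℤ) → (x ℤ.+ y) ℤ.* (z ℤ.* z) ≡ (x ℤ.* z ℤ.+ y ℤ.* z) ℤ.* z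
  cross = ℤ-Solver.solve-∀

frac-zero : ∀ N → frac 0 N ≡ 0ℚ
frac-zero zero    = refl
frac-zero (suc n) = fromℚᵘ-cong {mkℚᵘ (+ 0) n} {mkℚᵘ (+ 0) 0} (*≡* refl)

frac-self : ∀ N → 0 Nat.< N → frac N N ≡ 1ℚ
frac-self (suc n) _ = fromℚᵘ-cong {mkℚᵘ (+ suc n) n} {mkℚᵘ (+ 1) 0} (*≡* (ℤ.*-comm (+ suc n) (+ 1)))

frac-nonneg : ∀ a N → 0ℚ ≤ frac a N
frac-nonneg a zero    = ≤-refl
frac-nonneg a (suc n) = nonNegative⁻¹ (frac a (suc n)) {{normalize-nonNeg a (suc n)}}

frac-mono : ∀ {a b} N → a ≤ℕ b → frac a N ≤ frac b N
frac-mono zero    _   = ≤-refl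
frac-mono {a} {b} (suc n) a≤b = begin
  frac a (suc n)                             ≡⟨ +-identityʳ _ ⟨
  frac a (suc n) + 0ℚ                        ≤⟨ +-monoʳ-≤ (frac a (suc n)) (frac-nonneg (b Nat.∸ a) (suc n)) ⟩
  frac a (suc n) + frac (b Nat.∸ a) (suc n)  ≡⟨ frac-+ a (b Nat.∸ a) (suc n) (s≤s z≤n) ⟨
  frac (a Nat.+ (b Nat.∸ a)) (suc n)         ≡⟨ cong (λ c → frac c (suc n)) (Natₚ.m+[n∸m]≡n a≤b) ⟩
  frac b (suc n)                             ∎
  where open ≤-Reasoning

-- chain rule: (a / q) (q / N) = a / N, also when q = 0 (which forces a = 0)
frac-chain : ∀ a q N → 0 Nat.< N → a ≤ℕ q → frac a q * frac q N ≡ frac a N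
frac-chain .0 zero    N       _ z≤n = trans (*-zeroˡ (frac 0 N)) (sym (frac-zero N))
frac-chain a  (suc q) (suc n) _ _   = sym (trans
  (fromℚᵘ-cong {mkℚᵘ (+ a) n} {mkℚᵘ (+ a) q ℚᵘ.* mkℚᵘ (+ suc q) n}
    (*≡* (trans (cong (+ a ℤ.*_) (ℤ.pos-* (suc q) (suc n))) (sym (ℤ.*-assoc (+ a) (+ suc q) (+ suc n))))))
  (fromℚᵘ-homo-* (mkℚᵘ (+ a) q) (mkℚᵘ (+ suc q) n)))

frac-∑-scaled : {A : Set} {P : A → Set} (N : ℕ) → 0 Nat.< N → (α : ℚ) (xs : List A) (f g : A → ℕ)
  → All P xs → (∀ x → P x → frac (f x) N ≤ α * frac (g x) N)
  → frac (∑ xs f) N ≤ α * frac (∑ xs g) N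
frac-∑-scaled N N>0 α [] f g [] h =
  ≤-reflexive (trans (frac-zero N) (sym (trans (cong (α *_) (frac-zero N)) (*-zeroʳ α))))
frac-∑-scaled N N>0 α (x ∷ xs) f g (px ∷ pxs) h = begin
  frac (f x Nat.+ ∑ xs f) N               ≡⟨ frac-+ (f x) (∑ xs f) N N>0 ⟩
  frac (f x) N + frac (∑ xs f) N          ≤⟨ +-mono-≤ (h x px) (frac-∑-scaled N N>0 α xs f g pxs h) ⟩
  α * frac (g x) N + α * frac (∑ xs g) N  ≡⟨ *-distribˡ-+ α _ _ ⟨
  α * (frac (g x) N + frac (∑ xs g) N)    ≡⟨ cong (α *_) (frac-+ (g x) (∑ xs g) N N>0) ⟨
  α * frac (g x Nat.+ ∑ xs g) N           ∎
  where open ≤-Reasoning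

frac-∑-bounded : {A : Set} {P : A → Set} (N : ℕ) → 0 Nat.< N → (α : ℚ) (xs : List A) (f : A → ℕ)
  → All P xs → (∀ x → P x → frac (f x) N ≤ α) → frac (∑ xs f) N ≤ ℕ→ℚ (length xs) * α
frac-∑-bounded N N>0 α [] f [] h = ≤-reflexive (trans (frac-zero N) (sym (*-zeroˡ α)))
frac-∑-bounded N N>0 α (x ∷ xs) f (px ∷ pxs) h = begin
  frac (f x Nat.+ ∑ xs f) N       ≡⟨ frac-+ (f x) (∑ xs f) N N>0 ⟩
  frac (f x) N + frac (∑ xs f) N  ≤⟨ +-mono-≤ (h x px) (frac-∑-bounded N N>0 α xs f pxs h) ⟩
  α + ℕ→ℚ (length xs) * α         ≡⟨ cong (_+ ℕ→ℚ (length xs) * α) (*-identityˡ α) ⟨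
  1ℚ * α + ℕ→ℚ (length xs) * α    ≡⟨ *-distribʳ-+ α 1ℚ (ℕ→ℚ (length xs)) ⟨
  (1ℚ + ℕ→ℚ (length xs)) * α      ≡⟨ cong (_* α) (frac-+ 1 (length xs) 1 (s≤s z≤n)) ⟨
  ℕ→ℚ (length (x ∷ xs)) * α       ∎
  where open ≤-Reasoning

-- P(A ∩ C) = P(A | C) P(C) ≤ (c₂ p)(c₁ ι) for counts a = |A ∩ C| ≤ q = |C| out of N
chain-bound : ∀ a q N → 0 Nat.< N → a ≤ℕ q → (c₁ c₂ ι p : ℚ)
  → frac a q ≤ c₂ * p → frac q N ≤ c₁ * ι → frac a N ≤ c₁ * c₂ * ι * p
chain-bound a q N N>0 a≤q c₁ c₂ ι p cond marg = begin
  frac a N             ≡⟨ frac-chain a q N N>0 a≤q ⟨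
  frac a q * frac q N  ≤⟨ *-monoʳ-≤-nonNeg (frac q N) {{nonNegative (frac-nonneg q N)}} cond ⟩
  (c₂ * p) * frac q N  ≤⟨ *-monoˡ-≤-nonNeg (c₂ * p) {{nonNegative (≤-trans (frac-nonneg a q) cond)}} marg ⟩
  (c₂ * p) * (c₁ * ι)  ≡⟨ regroup c₂ p c₁ ι ⟩
  c₁ * c₂ * ι * p      ∎
  where
  open ≤-Reasoning
  regroup : ∀ c₂ p c₁ ι → (c₂ * p) * (c₁ * ι) ≡ c₁ * c₂ * ι * p
  regroup = solve 4 (λ c₂ p c₁ ι → (c₂ :* p) :* (c₁ :* ι) := c₁ :* c₂ :* ι :* p) refl
    where open +-*-Solver

sub-≤ : ∀ {p q r} → p ≤ q + r → p - r ≤ q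
sub-≤ {p} {q} {r} p≤q+r = ≤-trans (+-monoˡ-≤ (- r) p≤q+r) (≤-reflexive (cancel q r))
  where
  cancel : ∀ q r → (q + r) - r ≡ q
  cancel = solve 2 (λ q r → (q :+ r) :- r := q) refl
    where open +-*-Solver

kSets : (n k : ℕ) → List (Vec Bool n)
kSets n k = filter (λ W → ones W Nat.≟ k) (vecsOver (false ∷ true ∷ []) n)

kSets-sizes : {n k : ℕ} → All (λ W → ones W ≡ k) (kSets n k)
kSets-sizes {n} {k} = All.all-filter (λ W → ones W Nat.≟ k) (vecsOver (false ∷ true ∷ []) n)

kSets-once : {n k : ℕ} (v : Vec Bool n) → ones v ≡ k → ∑ (kSets n k) (λ W → 𝟙 (≡-dec Bool._≟_ v W)) ≡ 1
kSets-once {n} {k} v =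
  filter-once (≡-dec Bool._≟_) (λ W → ones W Nat.≟ k) (vecsOver (false ∷ true ∷ []) n) (boolVecs-once n) v

-- Neighbourhood events in 𝓑(d,k)

module _ {n : ℕ} (d : Vec ℕ n) (k : ℕ) where

  private
    m : ℕ
    m = mOf d k

  bothEq? : (i j : Fin m) (W : Vec Bool n) → Decidable (λ B → NbEq j W B × NbEq i W B)
  bothEq? i j W B = NbEq? j W B ×-dec NbEq? i W B

  collide? : (p : Fin m × Fin m) → Decidable (λ (B : Mat m n) → N_Y B (proj₁ p) ≡ N_Y B (proj₂ p))
  collide? (i , j) B = ≡-dec Bool._≟_ (N_Y B i) (N_Y B j)

  𝓑-members : All (InB d k) (𝓑 d k)
  𝓑-members = All.all-filter (InB? d k) (allMats m n)

  𝓑-nonempty : ∃ (InB d k) → 0 Nat.< length (𝓑 d k)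
  𝓑-nonempty (B , B∈𝓑) =
    ∑-nonempty (𝓑 d k) _ (filter-once (≡-dec (≡-dec Bool._≟_)) (InB? d k) (allMats m n) (allMats-once m n) B B∈𝓑)

  nbhd-once : (B : Mat m n) → InB d k B → (j : Fin m) → ∑ (kSets n k) (λ W → 𝟙 (NbEq? j W B)) ≡ 1
  nbhd-once B (_ , degY≡k) j = kSets-once (N_Y B j) (degY≡k j)

  nbhd-total : (j : Fin m) → ∑ (kSets n k) (λ W → count (NbEq? j W) (𝓑 d k)) ≡ length (𝓑 d k)
  nbhd-total j = count-partition (NbEq? j) (kSets n k) (𝓑 d k) (All.map (λ {B} B∈𝓑 → nbhd-once B B∈𝓑 j) 𝓑-members)

  -- a collision N(y_i) = N(y_j) happens at one k-set W = N(y_j), so its count splits over the W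
  collision-split : (i j : Fin m)
    → count (collide? (i , j)) (𝓑 d k) ≤ℕ ∑ (kSets n k) (λ W → count (bothEq? i j W) (𝓑 d k))
  collision-split i j = count-cover (collide? (i , j)) (bothEq? i j) (kSets n k) (𝓑 d k) (All.map (λ {B} → split {B}) 𝓑-members)
    where
    split : {B : Mat m n} → InB d k B → 𝟙 (collide? (i , j) B) ≤ℕ ∑ (kSets n k) (λ W → 𝟙 (bothEq? i j W B))
    split {B} B∈𝓑 with collide? (i , j) B
    ... | no _     = z≤n
    ... | yes i≡j = Natₚ.≤-reflexive (sym (trans
          (∑-cong (kSets n k) _ _ (λ W → 𝟙-cong proj₁ (λ eq → eq , trans i≡j eq) (bothEq? i j W B) (NbEq? j W B)))
          (nbhd-once B B∈𝓑 j)))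

  -- union bound: a graph that is not H-simple has a collision N(y_i) = N(y_j) at some pair i < j
  hsimple-union-bound :
    length (𝓑 d k) ≤ℕ count HSimple? (𝓑 d k) Nat.+ ∑ (pairs m) (λ p → count (collide? p) (𝓑 d k))
  hsimple-union-bound =
    union-bound HSimple? collide? (pairs m) (𝓑 d k) (λ B → collision (≡-dec Bool._≟_) (N_Y B))

  MarginalBound : ℚ → Set
  MarginalBound c₁ = (y : Fin m) (W : Vec Bool n) → ones W ≡ k → Prob d k (NbEq? y W) ≤ c₁ * inv (n C k)

  ConditionalBound : ℚ → Set
  ConditionalBound c₂ = (y y' : Fin m) → y ≢ y' → (W : Vec Bool n) → ones W ≡ k
    → CondProb d k (NbEq? y' W) (NbEq? y W) ≤ c₂ * Prob d k (NbEq? y' W)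

  collision-prob : (c₁ c₂ : ℚ) → 0 Nat.< length (𝓑 d k) → MarginalBound c₁ → ConditionalBound c₂
    → (i j : Fin m) → i ≢ j → frac (count (collide? (i , j)) (𝓑 d k)) (length (𝓑 d k)) ≤ c₁ * c₂ * inv (n C k)
  collision-prob c₁ c₂ N>0 marginal conditional i j i≢j = begin
    frac (count (collide? (i , j)) 𝓛) N
      ≤⟨ frac-mono N (collision-split i j) ⟩
    frac (∑ (kSets n k) (λ W → count (bothEq? i j W) 𝓛)) N
      ≤⟨ frac-∑-scaled N N>0 α (kSets n k) _ _ kSets-sizes joint ⟩
    α * frac (∑ (kSets n k) (λ W → count (NbEq? j W) 𝓛)) N
      ≡⟨ cong (λ c → α * frac c N) (nbhd-total j) ⟩
    α * frac N N
      ≡⟨ trans (cong (α *_) (frac-self N N>0)) (*-identityʳ α) ⟩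
    α ∎
    where
    open ≤-Reasoning
    𝓛 = 𝓑 d k
    N = length 𝓛
    α = c₁ * c₂ * inv (n C k)
    joint : (W : Vec Bool n) → ones W ≡ k → frac (count (bothEq? i j W) 𝓛) N ≤ α * frac (count (NbEq? j W) 𝓛) N
    joint W |W|≡k = chain-bound _ _ N N>0 (count-×-≤ (NbEq? j W) (NbEq? i W) 𝓛) c₁ c₂ (inv (n C k)) _
      (conditional i j i≢j W |W|≡k) (marginal i W |W|≡k)

  collisions-prob : (c₁ c₂ : ℚ) → 0 Nat.< length (𝓑 d k) → MarginalBound c₁ → ConditionalBound c₂
    → frac (∑ (pairs m) (λ p → count (collide? p) (𝓑 d k))) (length (𝓑 d k)) ≤ c₁ * c₂ * ℕ→ℚ (m C 2) * inv (n C k)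
  collisions-prob c₁ c₂ N>0 marginal conditional = begin
    frac (∑ (pairs m) (λ p → count (collide? p) (𝓑 d k))) (length (𝓑 d k))
      ≤⟨ frac-∑-bounded _ N>0 α (pairs m) _ (pairs-distinct m)
           (λ { (i , j) → collision-prob c₁ c₂ N>0 marginal conditional i j }) ⟩
    ℕ→ℚ (length (pairs m)) * α
      ≡⟨ cong (λ c → ℕ→ℚ c * α) (pairs-length m) ⟩
    ℕ→ℚ (m C 2) * α
      ≡⟨ regroup (ℕ→ℚ (m C 2)) c₁ c₂ (inv (n C k)) ⟩
    c₁ * c₂ * ℕ→ℚ (m C 2) * inv (n C k) ∎
    where
    open ≤-Reasoning
    α = c₁ * c₂ * inv (n C k)
    regroup : ∀ C c₁ c₂ ι → C * (c₁ * c₂ * ι) ≡ c₁ * c₂ * C * ι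
    regroup = solve 4 (λ C c₁ c₂ ι → C :* (c₁ :* c₂ :* ι) := c₁ :* c₂ :* C :* ι) refl
      where open +-*-Solver

lemma3p1 : (k n : ℕ) → 3 ≤ℕ k → (d : Vec ℕ n)
    → ∃ (λ B → InB d k B)
    → (c₁ c₂ : ℚ)
    → ((y : Fin (mOf d k)) (W : Vec Bool n) → ones W ≡ k
        → Prob d k (NbEq? y W) ≤ c₁ * inv (n C k))
    → ((y y' : Fin (mOf d k)) → y ≢ y' → (W : Vec Bool n) → ones W ≡ k
        → CondProb d k (NbEq? y' W) (NbEq? y W) ≤ c₂ * Prob d k (NbEq? y' W))
    → 1ℚ - c₁ * c₂ * ℕ→ℚ (mOf d k C 2) * inv (n C k) ≤ Prob d k HSimple?
lemma3p1 k n _ d nonempty c₁ c₂ marginal conditional = sub-≤ (begin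
  1ℚ                                                             ≡⟨ frac-self N N>0 ⟨
  frac N N                                                       ≤⟨ frac-mono N (hsimple-union-bound d k) ⟩
  frac (count HSimple? (𝓑 d k) Nat.+ S) N                        ≡⟨ frac-+ _ S N N>0 ⟩
  Prob d k HSimple? + frac S N                                   ≤⟨ +-monoʳ-≤ (Prob d k HSimple?) (collisions-prob d k c₁ c₂ N>0 marginal conditional) ⟩
  Prob d k HSimple? + c₁ * c₂ * ℕ→ℚ (mOf d k C 2) * inv (n C k)  ∎)
  where
  open ≤-Reasoning
  N = length (𝓑 d k)
  N>0 = 𝓑-nonempty d k nonempty
  S = ∑ (pairs (mOf d k)) (λ p → count (collide? d k p) (𝓑 d k))
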